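{- Let $\alpha=wX\beta$ with $w\in T^*$, $X\in N$, and let $\ell=\ell'.i.\ell''$ be a sequence of levels associated to $\alpha$ (with $\ell'$ for $w$, $i$ for $X$, $\ell''$ for $\beta$) that assigns a positive value to every non-terminal of $\alpha$. For a rule $X\to\eta$ let $\ell_\eta=\ell'.(i-1)^{|\eta|}.\ell''$. Let $c$ be a choice function for $\alpha$ and $\ell$. (1) If $X\in N_\square$, then for every rule $X\to\eta$ there is a choice function $c_\eta$ for $w\eta\beta$ and $\ell_\eta$ that refines $c$. (2) If $X\in N_\bigcirc$, then there is a rule $X\to\eta$ and a choice function $c_\eta$ for $w\eta\beta$ and $\ell_\eta$ that refines $c$.
   Context: $G=(N_{\bigcirc}\,\dot\cup\,N_{\square},T,P)$ is a context-free grammar with disjoint finite sets of non-terminals $N=N_\bigcirc\cup N_\square$ (owned by refuter and prover) and terminals $T$, finitely many rules $X\to\eta$, every non-terminal having a rule; $A=(T,Q,q_0,Q_F,\to)$ is a finite automaton. Boxes are subsets of $Q\times Q$, composed relationally ($\rho;\tau=\{(q,q''):\exists q'.(q,q')\in\rho,(q',q'')\in\tau\}$), $\mathrm{id}=\{(q,q)\}$, $[a]=\{(q,q'):q\xrightarrow{a}q'\}$. Formulas are CNF formulas: finite sets of clauses, each a finite set of boxes; $\mathit{false}=\{\{\}\}$. Operations: $F\wedge G=F\cup G$; $F\vee G=\{K\cup H:K\in F,H\in G\}$; $F;G=\bigcup_{K\in F}\bigcup_{z:K\to G}\{\bigcup_{\rho\in K}\{\rho;\tau:\tau\in z(\rho)\}\}$.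 Kleene approximants: $\sigma^0(X)=\mathit{false}$; for $X$ with rules $X\to\eta_1,\dots,X\to\eta_k$, $\sigma^{i+1}(X)=\bigwedge_j\sigma^i(\eta_j)$ if $X\in N_\square$ and $\bigvee_j\sigma^i(\eta_j)$ if $X\in N_\bigcirc$, where $\sigma^i(\varepsilon)=\{\{\mathrm{id}\}\}$, $\sigma^i(a)=\{\{[a]\}\}$, $\sigma^i(\alpha\beta)=\sigma^i(\alpha);\sigma^i(\beta)$. For $\alpha=x_1\cdots x_n$ and $\ell=\ell_1\cdots\ell_n\in\mathbb{N}^n$ (a sequence of levels associated to $\alpha$), $\sigma^\ell(\alpha)=\sigma^{\ell_1}(x_1);\cdots;\sigma^{\ell_n}(x_n)$. A choice function on a CNF $F$ is $c$ with $c(K)\in K$ for all $K\in F$; a choice function for $\alpha$ and $\ell$ is one on $\sigma^\ell(\alpha)$. A choice function $c'$ on $F'$ refines $c$ on $F$ if $\{c'(H):H\in F'\}\subseteq\{c(K):K\in F\}$. -}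

module Defs where

open import Level using (Level; 0ℓ; Lift) renaming (suc to lsuc)
open import Data.Nat using (ℕ; zero; suc; _∸_; _<_)
open import Data.Bool using (Bool; true; false; _∧_; if_then_else_)
open import Data.Fin using (Fin)
open import Data.Fin.Properties using (_≟_)
open import Data.Vec using (Vec; tabulate; lookup)
open import Data.List using (List; []; _∷_; _++_; map; allFin)
open import Data.Bool.ListAction using (any)
open import Data.List.Membership.Propositional using (_∈_)
open import Data.Product using (Σ; ∃; _×_; _,_)
open import Data.Sum using (_⊎_; inj₁; inj₂)
open import Data.Empty using (⊥)
open import Function.Bundles using (_⇔_)
open import Relation.Binary.PropositionalEquality using (_≡_)
open import Relation.Nullary.Decidable using (⌊_⌋)

-- Owners of non-terminals: refuter owns N○ ("circle"), prover owns N□ ("box").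
data Owner : Set where
  refuter prover : Owner

record Grammar : Set where
  field
    nT nN : ℕ
    owner : Fin nN → Owner
  Sym : Set
  Sym = Fin nT ⊎ Fin nN
  field
    rules   : List (Fin nN × List (Fin nT ⊎ Fin nN))
    hasRule : ∀ X → ∃ λ η → (X , η) ∈ rules

record Automaton (nT : ℕ) : Set where
  field
    nQ    : ℕ
    q₀    : Fin nQ
    final : Fin nQ → Bool
    step  : Fin nT → Fin nQ → Fin nQ → Bool   -- q -a-> q'

module Semantics (G : Grammar) (A : Automaton (Grammar.nT G)) where
  open Grammar G public using (owner; Sym; rules)
  open Grammar G using (nT; nN)
  open Automaton A

  T N : Set
  T = Fin nT
  N = Fin nN

  -- Boxes: subsets of Q × Q, as Boolean matrices (so ≡ is extensional).
  Box : Set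
  Box = Vec (Vec Bool nQ) nQ

  _∋_ : Box → Fin nQ × Fin nQ → Bool
  ρ ∋ (q , q') = lookup (lookup ρ q) q'

  _⨾_ : Box → Box → Box
  ρ ⨾ τ = tabulate λ q → tabulate λ q'' →
            any (λ q' → (ρ ∋ (q , q')) ∧ (τ ∋ (q' , q''))) (allFin nQ)

  idBox : Box
  idBox = tabulate λ q → tabulate λ q' → ⌊ q ≟ q' ⌋

  [_] : T → Box
  [ a ] = tabulate λ q → tabulate λ q' → step a q q'

  Clause : Set₁
  Clause = Box → Set

  _≐_ : Clause → Clause → Set₁
  K ≐ H = Lift (lsuc 0ℓ) (∀ ρ → K ρ ⇔ H ρ)

  -- CNF formulas: sets of clauses, represented by membership predicates;
  -- all formulas built below are closed under ≐, i.e. they are sets of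
  -- clauses-as-sets.
  Formula : Set₂
  Formula = Clause → Set₁

  ffalse : Formula
  ffalse C = C ≐ (λ _ → ⊥)

  unit : Box → Formula
  unit ρ C = C ≐ (λ b → b ≡ ρ)

  _⨾F_ : Formula → Formula → Formula
  (F ⨾F G) C = Σ Clause λ K → F K × Σ (Box → Clause) λ z →
                 (∀ ρ → K ρ → G (z ρ)) ×
                 (C ≐ λ b → Σ Box λ ρ → Σ Box λ τ → K ρ × z ρ τ × b ≡ ρ ⨾ τ)

  _⟶_ : N → List Sym → Set
  X ⟶ η = (X , η) ∈ rules

  -- ⋀_{X→η} F_η  (iterated ∧ = union)
  ⋀rules : N → (List Sym → Formula) → Formula
  ⋀rules X F C = Σ (List Sym) λ η → X ⟶ η × F η C

  -- ⋁_{X→η} F_η  (iterated ∨: unions of one clause from each F_η)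
  ⋁rules : N → (List Sym → Formula) → Formula
  ⋁rules X F C = Σ (List Sym → Clause) λ z → (∀ η → X ⟶ η → F η (z η)) ×
                   (C ≐ λ b → Σ (List Sym) λ η → X ⟶ η × z η b)

  mutual
    σN : ℕ → N → Formula
    σN zero    X = ffalse
    σN (suc i) X with owner X
    ... | prover  = ⋀rules X (σW i)
    ... | refuter = ⋁rules X (σW i)

    σS : ℕ → Sym → Formula
    σS i (inj₁ a) = unit [ a ]
    σS i (inj₂ Y) = σN i Y

    σW : ℕ → List Sym → Formula
    σW i []      = unit idBox
    σW i (x ∷ α) = σS i x ⨾F σW i α

  -- Sentential forms paired with their sequence of levels ℓ.
  LSeq : Set
  LSeq = List (Sym × ℕ)

  σL : LSeq → Formula
  σL []            = unit idBox
  σL ((x , l) ∷ α) = σS l x ⨾F σL α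

  record IsChoice (F : Formula) (c : Clause → Box) : Set₁ where
    field
      chooses  : ∀ K → F K → K (c K)
      wellDef  : ∀ K H → K ≐ H → c K ≡ c H

  Refines : Formula → (Clause → Box) → Formula → (Clause → Box) → Set₁
  Refines F' c' F c = ∀ H → F' H → Σ Clause λ K → F K × c' H ≡ c K

  -- w with its levels ℓ', as a levelled sentential form
  termSeq : List (T × ℕ) → LSeq
  termSeq = map λ { (a , l) → (inj₁ a , l) }

  constLevels : ℕ → List Sym → LSeq
  constLevels i = map λ x → (x , i)

-- Call a set S of boxes a hit if it contains c(K) for some clause K of σ^ℓ(wXβ). A
-- choice function for wηβ refining c exists as soon as every set containing a clause
-- of σ^ℓη(wηβ) is a hit: it picks, for each clause H, such a c(K) inside H. For a
-- prover's X, σ^i(X) is the conjunction of the σ^(i-1)(η), so a set containing a clause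
-- of σ^ℓη(wηβ) already contains one of σ^ℓ(wXβ), hence contains its c-value. For a
-- refuter's X, suppose every rule η had a set S_η that contains a clause of σ^ℓη(wηβ)
-- but is not a hit. Since σ^i(X) is the disjunction of the σ^(i-1)(η), the union of the
-- S_η contains a clause K of σ^ℓ(wXβ), so c(K) lies in some S_η, a contradiction.
--
-- Constructively all of this is a finite search: boxes are Boolean matrices, every
-- clause of a Kleene approximant is decidable, and whether a set of boxes contains a
-- clause of an approximant is computed by a Boolean test that comes with a canonical
-- such clause. Canonicity matters because choice functions must respect ≐.

module Submission where

open import Defs
open import Level using (lift)
open import Data.Nat using (ℕ; zero; suc; _<_; _∸_)
open import Data.Bool using (Bool; true; false; _∧_)
open import Data.Bool.Properties using (T-∧) renaming (_≟_ to _≟ᵇ_)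
open import Data.Bool.ListAction using (any; all)
open import Data.Fin using (Fin)
open import Data.Fin.Properties using () renaming (_≟_ to _≟ᶠ_)
open import Data.Vec using (Vec; []; _∷_; tabulate; lookup)
open import Data.Vec.Properties using (lookup∘tabulate; tabulate∘lookup; tabulate-cong)
import Data.Vec.Properties as Vec
open import Data.List using (List; []; _∷_; _++_; map; allFin; cartesianProductWith; filter; filterᵇ; findᵇ)
import Data.List.Properties as List
import Data.Product.Properties as Product
import Data.Sum.Properties as Sum
open import Data.List.Membership.Propositional using (_∈_; lose; find)
open import Data.List.Membership.Propositional.Properties
  using (∈-allFin; ∈-cartesianProductWith⁺; ∈-map⁺; ∈-++⁺ˡ; ∈-++⁺ʳ; ∈-filter⁺; ∈-filter⁻)
open import Data.List.Relation.Unary.Any using (here; there; satisfied; any?)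
open import Data.List.Relation.Unary.Any.Properties using (any⁺; any⁻)
import Data.List.Relation.Unary.All as All
open import Data.List.Relation.Unary.All.Properties using (all⁺; all⁻)
open import Data.Maybe using (Maybe; just; nothing; is-just; is-nothing; maybe′; fromMaybe)
open import Data.Maybe.Properties using (just-injective)
open import Data.Product using (Σ; ∃; _×_; _,_; proj₁; proj₂)
open import Data.Sum using (inj₁; inj₂)
open import Data.Empty using (⊥; ⊥-elim)
open import Function using (_∘_; id)
open import Function.Bundles using (_⇔_; mk⇔; Equivalence)
open import Function.Properties.Equivalence using () renaming (trans to ⇔-trans; sym to ⇔-sym)
open import Relation.Nullary using (Dec; yes; no)
open import Relation.Nullary.Decidable using (map′; _×-dec_; ⌊_⌋; toWitness; fromWitness; T?)
open import Relation.Binary.PropositionalEquality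
  using (_≡_; refl; sym; trans; cong; subst; module ≡-Reasoning)

-- Data.Bool's T is opened only inside modules: in the theorem, T names the terminals.
module FiniteSearch where
  open import Data.Bool using (T)

  private
    variable
      A : Set

  T-⇔⇒≡ : {x y : Bool} → (T x ⇔ T y) → x ≡ y
  T-⇔⇒≡ {false} {false} _ = refl
  T-⇔⇒≡ {false} {true}  e = ⊥-elim (Equivalence.from e _)
  T-⇔⇒≡ {true}  {false} e = ⊥-elim (Equivalence.to e _)
  T-⇔⇒≡ {true}  {true}  _ = refl

  ×-dec-under : {P Q : Set} → Dec P → (P → Dec Q) → Dec (P × Q)
  ×-dec-under (yes p) q? = map′ (p ,_) proj₂ (q? p)
  ×-dec-under (no ¬p) _  = no (¬p ∘ proj₁)

  Σ-dec-within : {P : A → Set} (xs : List A) → (∀ {x} → P x → x ∈ xs) →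
                 (∀ x → Dec (P x)) → Dec (Σ A P)
  Σ-dec-within xs bound P? = map′ satisfied (λ (x , px) → lose (bound px) px) (any? P? xs)

  vectors : List A → (n : ℕ) → List (Vec A n)
  vectors xs zero    = [] ∷ []
  vectors xs (suc n) = cartesianProductWith _∷_ xs (vectors xs n)

  ∈-vectors : {xs : List A} → (∀ x → x ∈ xs) → ∀ {n} (v : Vec A n) → v ∈ vectors xs n
  ∈-vectors every []      = here refl
  ∈-vectors every (x ∷ v) = ∈-cartesianProductWith⁺ _∷_ (every x) (∈-vectors every v)

  sublists : List A → List (List A)
  sublists []       = [] ∷ []
  sublists (x ∷ xs) = map (x ∷_) (sublists xs) ++ sublists xs

  filterᵇ∈sublists : (p : A → Bool) (xs : List A) → filterᵇ p xs ∈ sublists xs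
  filterᵇ∈sublists p []       = here refl
  filterᵇ∈sublists p (x ∷ xs) with p x
  ... | true  = ∈-++⁺ˡ (∈-map⁺ (x ∷_) (filterᵇ∈sublists p xs))
  ... | false = ∈-++⁺ʳ _ (filterᵇ∈sublists p xs)

  module _ (p : A → Bool) where

    findᵇ-sound : ∀ xs {x} → findᵇ p xs ≡ just x → x ∈ xs × T (p x)
    findᵇ-sound (y ∷ xs) eq with p y in py
    findᵇ-sound (y ∷ xs) refl | true = here refl , subst T (sym py) _
    ... | false = let m , px = findᵇ-sound xs eq in there m , px

    findᵇ-complete : ∀ {xs x} → x ∈ xs → T (p x) → T (is-just (findᵇ p xs))
    findᵇ-complete {y ∷ xs} m px with p y in py
    ... | true = _
    findᵇ-complete {y ∷ xs} (here refl) px | false = ⊥-elim (subst T py px)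
    findᵇ-complete {y ∷ xs} (there m)   px | false = findᵇ-complete m px

  findᵇ-cong : {p q : A → Bool} → (∀ x → p x ≡ q x) → ∀ xs → findᵇ p xs ≡ findᵇ q xs
  findᵇ-cong p≗q []       = refl
  findᵇ-cong p≗q (x ∷ xs) rewrite p≗q x | findᵇ-cong p≗q xs = refl

  is-just⇒just : {m : Maybe A} → T (is-just m) → ∃ λ x → m ≡ just x
  is-just⇒just {m = just x} _ = x , refl

  is-just∧is-nothing : {m : Maybe A} → T (is-just m) → T (is-nothing m) → ⊥
  is-just∧is-nothing {m = just _} _ ()


module Development (G : Grammar) (A : Automaton (Grammar.nT G)) where
  open import Data.Bool using (T)
  open FiniteSearch
  open Semantics G A renaming (T to Terminal)
  open Automaton A using (nQ)

  ∋-tabulate : (f : Fin nQ → Fin nQ → Bool) (q q' : Fin nQ) →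
               tabulate (λ q → tabulate (f q)) ∋ (q , q') ≡ f q q'
  ∋-tabulate f q q' rewrite lookup∘tabulate (λ q → tabulate (f q)) q = lookup∘tabulate (f q) q'

  ∋-⨾ : ∀ ρ τ {q q''} → T ((ρ ⨾ τ) ∋ (q , q'')) ⇔ ∃ λ q' → T (ρ ∋ (q , q')) × T (τ ∋ (q' , q''))
  ∋-⨾ ρ τ {q} {q''} = mk⇔ to from
    where
    path : Fin nQ → Bool
    path q' = (ρ ∋ (q , q')) ∧ (τ ∋ (q' , q''))
    unfold : (ρ ⨾ τ) ∋ (q , q'') ≡ any path (allFin nQ)
    unfold = ∋-tabulate (λ q q'' → any (λ q' → (ρ ∋ (q , q')) ∧ (τ ∋ (q' , q''))) (allFin nQ)) q q''
    to : T ((ρ ⨾ τ) ∋ (q , q'')) → ∃ λ q' → T (ρ ∋ (q , q')) × T (τ ∋ (q' , q''))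
    to t = let q' , t' = satisfied (any⁻ path (allFin nQ) (subst T unfold t)) in q' , Equivalence.to T-∧ t'
    from : (∃ λ q' → T (ρ ∋ (q , q')) × T (τ ∋ (q' , q''))) → T ((ρ ⨾ τ) ∋ (q , q''))
    from (q' , t) = subst T (sym unfold) (any⁺ path (lose (∈-allFin q') (Equivalence.from T-∧ t)))

  ∋-id : ∀ {q q'} → T (idBox ∋ (q , q')) ⇔ q ≡ q'
  ∋-id {q} {q'} rewrite ∋-tabulate (λ q q' → ⌊ q ≟ᶠ q' ⌋) q q' = mk⇔ toWitness fromWitness

  box-ext : ∀ {ρ τ} → (∀ q q' → T (ρ ∋ (q , q')) ⇔ T (τ ∋ (q , q'))) → ρ ≡ τ
  box-ext {ρ} {τ} same = begin
    ρ                                                  ≡⟨ sym (tabulate-∋ ρ) ⟩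
    tabulate (λ q → tabulate (λ q' → ρ ∋ (q , q')))   ≡⟨ tabulate-cong (λ q → tabulate-cong (λ q' → T-⇔⇒≡ (same q q'))) ⟩
    tabulate (λ q → tabulate (λ q' → τ ∋ (q , q')))   ≡⟨ tabulate-∋ τ ⟩
    τ                                                  ∎
    where
    open ≡-Reasoning
    tabulate-∋ : ∀ σ → tabulate (λ q → tabulate (λ q' → σ ∋ (q , q'))) ≡ σ
    tabulate-∋ σ = trans (tabulate-cong (λ q → tabulate∘lookup (lookup σ q))) (tabulate∘lookup σ)

  ⨾-identityˡ : ∀ τ → idBox ⨾ τ ≡ τ
  ⨾-identityˡ τ = box-ext λ q q'' → mk⇔
    (λ t → let q' , i , t' = Equivalence.to (∋-⨾ idBox τ) t
           in subst (λ p → T (τ ∋ (p , q''))) (sym (Equivalence.to ∋-id i)) t')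
    (λ t → Equivalence.from (∋-⨾ idBox τ) (q , Equivalence.from ∋-id refl , t))

  ⨾-assoc : ∀ ρ σ τ → (ρ ⨾ σ) ⨾ τ ≡ ρ ⨾ (σ ⨾ τ)
  ⨾-assoc ρ σ τ = box-ext λ q q''' → mk⇔
    (λ t → let q'' , ρσ , τ' = Equivalence.to (∋-⨾ (ρ ⨾ σ) τ) t
               q'  , ρ' , σ' = Equivalence.to (∋-⨾ ρ σ) ρσ
           in Equivalence.from (∋-⨾ ρ (σ ⨾ τ)) (q' , ρ' , Equivalence.from (∋-⨾ σ τ) (q'' , σ' , τ')))
    (λ t → let q' , ρ' , στ = Equivalence.to (∋-⨾ ρ (σ ⨾ τ)) t
               q'' , σ' , τ' = Equivalence.to (∋-⨾ σ τ) στ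
           in Equivalence.from (∋-⨾ (ρ ⨾ σ) τ) (q'' , Equivalence.from (∋-⨾ ρ σ) (q' , ρ' , σ') , τ'))

  _≟Box_ : (ρ τ : Box) → Dec (ρ ≡ τ)
  _≟Box_ = Vec.≡-dec (Vec.≡-dec _≟ᵇ_)

  allBoxes : List Box
  allBoxes = vectors (vectors (true ∷ false ∷ []) nQ) nQ

  ∈-allBoxes : ∀ ρ → ρ ∈ allBoxes
  ∈-allBoxes = ∈-vectors (∈-vectors λ { true → here refl ; false → there (here refl) })

  ∃Box-dec : {P : Box → Set} → (∀ ρ → Dec (P ρ)) → Dec (Σ Box P)
  ∃Box-dec = Σ-dec-within allBoxes (λ {ρ} _ → ∈-allBoxes ρ)

  Pred : Set
  Pred = Box → Bool

  _⊆ₚ_ : Clause → Pred → Set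
  K ⊆ₚ S = ∀ {b} → K b → T (S b)

  _≈ₚ_ : Clause → Pred → Set
  K ≈ₚ S = ∀ b → K b ⇔ T (S b)

  residual : Box → Pred → Pred
  residual ρ S τ = S (ρ ⨾ τ)

  DecClause : Clause → Set
  DecClause K = ∀ b → Dec (K b)

  ≐-refl : ∀ {K} → K ≐ K
  ≐-refl = lift λ _ → mk⇔ id id

  ≐-dec : ∀ {K H} → K ≐ H → DecClause H → DecClause K
  ≐-dec (lift K≐H) H? b = map′ (Equivalence.from (K≐H b)) (Equivalence.to (K≐H b)) (H? b)

  _⟶?_ : ∀ X η → Dec (X ⟶ η)
  X ⟶? η = (X , η) ∈? rules
    where open import Data.List.Membership.DecPropositional
            (Product.≡-dec _≟ᶠ_ (List.≡-dec (Sum.≡-dec _≟ᶠ_ _≟ᶠ_)))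

  rulesOf : N → List (List Sym)
  rulesOf X = filter (X ⟶?_) (map proj₂ rules)

  ∈-rulesOf⁺ : ∀ {X η} → X ⟶ η → η ∈ rulesOf X
  ∈-rulesOf⁺ {X} r = ∈-filter⁺ (X ⟶?_) (∈-map⁺ proj₂ r) r

  ∈-rulesOf⁻ : ∀ {X η} → η ∈ rulesOf X → X ⟶ η
  ∈-rulesOf⁻ {X} m = proj₂ (∈-filter⁻ (X ⟶?_) {xs = map proj₂ rules} m)

  record Decider (F : Formula) : Set₂ where
    field
      sat          : Pred → Bool
      witness      : Pred → Clause
      witness-∈    : ∀ {S} → T (sat S) → F (witness S)
      witness-⊆    : ∀ {S} → T (sat S) → witness S ⊆ₚ S
      sat-complete : ∀ {S K} → F K → K ⊆ₚ S → T (sat S)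
      clause-dec   : ∀ {K} → F K → DecClause K

    sat-mono : ∀ {S S'} → (∀ {b} → T (S b) → T (S' b)) → T (sat S) → T (sat S')
    sat-mono S⊆S' s = sat-complete (witness-∈ s) (S⊆S' ∘ witness-⊆ s)

  open Decider

  unit-decider : ∀ ρ → Decider (unit ρ)
  unit-decider ρ = record
    { sat          = λ S → S ρ
    ; witness      = λ _ b → b ≡ ρ
    ; witness-∈    = λ _ → ≐-refl
    ; witness-⊆    = λ { s refl → s }
    ; sat-complete = λ { (lift K≐ρ) K⊆S → K⊆S (Equivalence.from (K≐ρ ρ) refl) }
    ; clause-dec   = λ K≐ρ → ≐-dec K≐ρ (_≟Box ρ)
    }

  -- ffalse = {{}}, and its empty clause lies in every S.
  false-decider : Decider ffalse
  false-decider = record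
    { sat          = λ _ → true
    ; witness      = λ _ _ → ⊥
    ; witness-∈    = λ _ → ≐-refl
    ; witness-⊆    = λ _ ()
    ; sat-complete = λ _ _ → _
    ; clause-dec   = λ K≐∅ → ≐-dec K≐∅ (λ _ → no id)
    }

  ⨾-decider : ∀ {F H} → Decider F → Decider H → Decider (F ⨾F H)
  ⨾-decider {F} {H} DF DH = record
    { sat          = sat⨾
    ; witness      = witness⨾
    ; witness-∈    = λ s → _ , witness-∈ DF s , _ , (λ _ k → witness-∈ DH (witness-⊆ DF s k)) , ≐-refl
    ; witness-⊆    = λ { s (_ , _ , k , z , refl) → witness-⊆ DH (witness-⊆ DF s k) z }
    ; sat-complete = complete⨾
    ; clause-dec   = dec⨾
    }
    where
    continuation : Pred → Pred
    continuation S ρ = sat DH (residual ρ S)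
    sat⨾ : Pred → Bool
    sat⨾ S = sat DF (continuation S)
    witness⨾ : Pred → Clause
    witness⨾ S b = Σ Box λ ρ → Σ Box λ τ →
      witness DF (continuation S) ρ × witness DH (residual ρ S) τ × b ≡ ρ ⨾ τ
    complete⨾ : ∀ {S C} → (F ⨾F H) C → C ⊆ₚ S → T (sat⨾ S)
    complete⨾ (K , fK , z , hz , lift C≐) C⊆S = sat-complete DF fK λ {ρ} k →
      sat-complete DH (hz ρ k) λ {τ} zτ → C⊆S (Equivalence.from (C≐ (ρ ⨾ τ)) (ρ , τ , k , zτ , refl))
    dec⨾ : ∀ {C} → (F ⨾F H) C → DecClause C
    dec⨾ (K , fK , z , hz , C≐) = ≐-dec C≐ λ b → ∃Box-dec λ ρ → ∃Box-dec λ τ →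
      ×-dec-under (clause-dec DF fK ρ) λ k → clause-dec DH (hz ρ k) τ ×-dec (b ≟Box (ρ ⨾ τ))

  module _ (X : N) {F : List Sym → Formula} (D : ∀ η → Decider (F η)) where

    satisfiedBy : Pred → List Sym → Bool
    satisfiedBy S η = sat (D η) S

    firstSatRule : Pred → Maybe (List Sym)
    firstSatRule S = findᵇ (satisfiedBy S) (rulesOf X)

    satisfiedByAll : Pred → Bool
    satisfiedByAll S = all (satisfiedBy S) (rulesOf X)

    satisfiedByAll-rule : ∀ {S η} → T (satisfiedByAll S) → X ⟶ η → T (satisfiedBy S η)
    satisfiedByAll-rule s r = All.lookup (all⁺ _ _ s) (∈-rulesOf⁺ r)

    ⋀-decider : Decider (⋀rules X F)
    sat ⋀-decider S = is-just (firstSatRule S)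
    witness ⋀-decider S = maybe′ (λ η → witness (D η) S) (λ _ → ⊥) (firstSatRule S)
    witness-∈ ⋀-decider {S} s with firstSatRule S in first
    ... | just η = let m , sη = findᵇ-sound (satisfiedBy S) (rulesOf X) first
                   in η , ∈-rulesOf⁻ m , witness-∈ (D η) sη
    witness-⊆ ⋀-decider {S} s with firstSatRule S in first
    ... | just η = witness-⊆ (D η) (proj₂ (findᵇ-sound (satisfiedBy S) (rulesOf X) first))
    sat-complete ⋀-decider {S} (η , r , fK) K⊆S =
      findᵇ-complete (satisfiedBy S) (∈-rulesOf⁺ r) (sat-complete (D η) fK K⊆S)
    clause-dec ⋀-decider (η , _ , fK) = clause-dec (D η) fK

    ⋁-decider : Decider (⋁rules X F)
    sat ⋁-decider = satisfiedByAll
    witness ⋁-decider S b = Σ (List Sym) λ η → X ⟶ η × witness (D η) S b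
    witness-∈ ⋁-decider s = _ , (λ η r → witness-∈ (D η) (satisfiedByAll-rule s r)) , ≐-refl
    witness-⊆ ⋁-decider s (η , r , w) = witness-⊆ (D η) (satisfiedByAll-rule s r) w
    sat-complete ⋁-decider (z , hz , lift C≐) C⊆S = all⁻ _ (All.tabulate λ {η} m →
      let r = ∈-rulesOf⁻ m in
      sat-complete (D η) (hz η r) λ {b} zb → C⊆S (Equivalence.from (C≐ b) (η , r , zb)))
    clause-dec ⋁-decider (z , hz , C≐) = ≐-dec C≐ λ b →
      Σ-dec-within (rulesOf X) (∈-rulesOf⁺ ∘ proj₁) λ η →
        ×-dec-under (X ⟶? η) λ r → clause-dec (D η) (hz η r) b

  mutual
    deciderN : ∀ i X → Decider (σN i X)
    deciderN zero    X = false-decider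
    deciderN (suc i) X with owner X
    ... | prover  = ⋀-decider X (deciderW i)
    ... | refuter = ⋁-decider X (deciderW i)

    deciderS : ∀ i x → Decider (σS i x)
    deciderS i (inj₁ a) = unit-decider [ a ]
    deciderS i (inj₂ Y) = deciderN i Y

    deciderW : ∀ i η → Decider (σW i η)
    deciderW i []      = unit-decider idBox
    deciderW i (x ∷ η) = ⨾-decider (deciderS i x) (deciderW i η)

  deciderL : ∀ α → Decider (σL α)
  deciderL []            = unit-decider idBox
  deciderL ((x , l) ∷ α) = ⨾-decider (deciderS l x) (deciderL α)

  satW : ℕ → List Sym → Pred → Bool
  satW i η = sat (deciderW i η)

  satL : LSeq → Pred → Bool
  satL α = sat (deciderL α)

  satN-prover : ∀ {i X η S} → owner X ≡ prover → X ⟶ η → T (satW i η S) →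
                T (sat (deciderN (suc i) X) S)
  satN-prover {i} {X} {η} po r s with owner X
  satN-prover {i} {X} {η} refl r s | .prover =
    sat-complete (⋀-decider X (deciderW i))
      (η , r , witness-∈ (deciderW i η) s)
      (witness-⊆ (deciderW i η) s)

  satN-refuter : ∀ {i X S} → owner X ≡ refuter → (∀ {η} → X ⟶ η → T (satW i η S)) →
                 T (sat (deciderN (suc i) X) S)
  satN-refuter {i} {X} ro s with owner X
  satN-refuter {i} {X} refl s | .refuter =
    sat-complete (⋁-decider X (deciderW i))
      (_ , (λ η r → witness-∈ (deciderW i η) (s r)) , ≐-refl)
      (λ (η , r , w) → witness-⊆ (deciderW i η) (s r) w)

  residualWord : List (Terminal × ℕ) → Pred → Pred
  residualWord []            S = S
  residualWord ((a , _) ∷ w) S = residualWord w (residual [ a ] S)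

  satL-termSeq : ∀ w γ S → satL (termSeq w ++ γ) S ≡ satL γ (residualWord w S)
  satL-termSeq []            γ S = refl
  satL-termSeq ((a , _) ∷ w) γ S = satL-termSeq w γ (residual [ a ] S)

  satL-constLevels : ∀ j η β {S} → T (satL (constLevels j η ++ β) S) →
                     T (satW j η λ ρ → satL β (residual ρ S))
  satL-constLevels j []      β {S} = sat-mono (deciderL β) (subst (T ∘ S) (sym (⨾-identityˡ _)))
  satL-constLevels j (x ∷ η) β {S} = sat-mono (deciderS j x) λ {ρ} s →
    sat-mono (deciderW j η)
      (λ {σ} → sat-mono (deciderL β) λ {τ} → subst (T ∘ S) (sym (⨾-assoc ρ σ τ)))
      (satL-constLevels j η β s)

  satL-expand-prover : ∀ w {X} j β {η S} → owner X ≡ prover → X ⟶ η →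
    T (satL (termSeq w ++ constLevels j η ++ β) S) → T (satL (termSeq w ++ (inj₂ X , suc j) ∷ β) S)
  satL-expand-prover w {X} j β {η} {S} po r s
    rewrite satL-termSeq w (constLevels j η ++ β) S | satL-termSeq w ((inj₂ X , suc j) ∷ β) S =
    satN-prover po r (satL-constLevels j η β s)

  satL-expand-refuter : ∀ w {X} j β {S} → owner X ≡ refuter →
    (∀ {η} → X ⟶ η → T (satL (termSeq w ++ constLevels j η ++ β) S)) →
    T (satL (termSeq w ++ (inj₂ X , suc j) ∷ β) S)
  satL-expand-refuter w {X} j β {S} ro s
    rewrite satL-termSeq w ((inj₂ X , suc j) ∷ β) S =
    satN-refuter ro λ {η} r → satL-constLevels j η β (subst T (satL-termSeq w _ S) (s r))

  ⟦_⟧ : List Box → Pred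
  ⟦ L ⟧ b = ⌊ b ∈? L ⌋
    where open import Data.List.Membership.DecPropositional _≟Box_

  boxSets : List (List Box)
  boxSets = sublists allBoxes

  listing : Pred → List Box
  listing S = filterᵇ S allBoxes

  listing∈boxSets : ∀ S → listing S ∈ boxSets
  listing∈boxSets S = filterᵇ∈sublists S allBoxes

  listing-⇔ : ∀ {S b} → T (⟦ listing S ⟧ b) ⇔ T (S b)
  listing-⇔ {S} {b} = mk⇔
    (λ t → proj₂ (∈-filter⁻ (T? ∘ S) {xs = allBoxes} (toWitness t)))
    (λ t → fromWitness (∈-filter⁺ (T? ∘ S) (∈-allBoxes b) t))

  listing≗ : ∀ S b → ⟦ listing S ⟧ b ≡ S b
  listing≗ S b = T-⇔⇒≡ listing-⇔

  ≈ₚ-unique : ∀ {H S S'} → H ≈ₚ S → H ≈ₚ S' → ∀ b → S b ≡ S' b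
  ≈ₚ-unique H≈S H≈S' b = T-⇔⇒≡ (⇔-trans (⇔-sym (H≈S b)) (H≈S' b))

  RefiningChoice : LSeq → LSeq → (Clause → Box) → Set₁
  RefiningChoice α' α c =
    Σ (Clause → Box) λ c' → IsChoice (σL α') c' × Refines (σL α') c' (σL α) c

  module Refinement (α : LSeq) (c : Clause → Box) (isC : IsChoice (σL α) c) where
    open IsChoice isC

    pick : List Box → Box
    pick L = c (witness (deciderL α) ⟦ L ⟧)

    hits : Pred → List Box → Bool
    hits S L = satL α ⟦ L ⟧ ∧ S (pick L)

    firstHit : Pred → Maybe (List Box)
    firstHit S = findᵇ (hits S) boxSets

    firstHit-cong : ∀ {S S'} → (∀ b → S b ≡ S' b) → firstHit S ≡ firstHit S'
    firstHit-cong S≗S' = findᵇ-cong (λ L → cong (satL α ⟦ L ⟧ ∧_) (S≗S' (pick L))) boxSets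

    hits-listing : ∀ {S} → T (satL α S) → T (hits S (listing S))
    hits-listing {S} s = Equivalence.from T-∧ (s' , Equivalence.to listing-⇔ picked)
      where
      s' : T (satL α ⟦ listing S ⟧)
      s' = sat-mono (deciderL α) (Equivalence.from listing-⇔) s
      picked : T (⟦ listing S ⟧ (pick (listing S)))
      picked = witness-⊆ (deciderL α) s' (chooses _ (witness-∈ (deciderL α) s'))

    Covered : LSeq → Set
    Covered α' = ∀ {S} → T (satL α' S) → T (is-just (firstHit S))

    covered-by-sat : ∀ α' → (∀ {S} → T (satL α' S) → T (satL α S)) → Covered α'
    covered-by-sat α' α'⇒α {S} s =
      findᵇ-complete (hits S) (listing∈boxSets S) (hits-listing (α'⇒α s))

    refining-choice : ∀ α' → Covered α' → RefiningChoice α' α c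
    refining-choice α' covered = c' , isChoice , refines
      where
      -- A decision procedure for H is only available from a proof of σL α' H, so c' is
      -- computed at a clause defined from H alone; it is ≐ to witness ⟦ L₀ ⟧ below.
      canonical : Clause → Clause
      canonical H b = Σ Pred λ S → H ≈ₚ S × Σ (List Box) λ L →
                        firstHit S ≡ just L × witness (deciderL α) ⟦ L ⟧ b

      c' : Clause → Box
      c' H = c (canonical H)

      canonical-cong : ∀ {K H} → K ≐ H → canonical K ≐ canonical H
      canonical-cong (lift K≐H) = lift λ b → mk⇔
        (λ (S , K≈S , rest) → S , (λ b' → ⇔-trans (⇔-sym (K≐H b')) (K≈S b')) , rest)
        (λ (S , H≈S , rest) → S , (λ b' → ⇔-trans (K≐H b') (H≈S b')) , rest)

      module _ {H : Clause} (hH : σL α' H) where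
        S₀ : Pred
        S₀ b = ⌊ clause-dec (deciderL α') hH b ⌋

        H≈S₀ : H ≈ₚ S₀
        H≈S₀ b = mk⇔ fromWitness toWitness

        found : ∃ λ L → firstHit S₀ ≡ just L
        found = is-just⇒just (covered (sat-complete (deciderL α') hH (Equivalence.to (H≈S₀ _))))

        L₀ : List Box
        L₀ = proj₁ found

        hit : T (satL α ⟦ L₀ ⟧) × T (S₀ (pick L₀))
        hit = Equivalence.to T-∧ (proj₂ (findᵇ-sound (hits S₀) boxSets (proj₂ found)))

        canonical≐ : canonical H ≐ witness (deciderL α) ⟦ L₀ ⟧
        canonical≐ = lift λ b → mk⇔
          (λ (S , H≈S , L , first , w) →
             subst (λ L → witness (deciderL α) ⟦ L ⟧ b)
                   (just-injective (begin
                      just L         ≡⟨ sym first ⟩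
                      firstHit S     ≡⟨ firstHit-cong (≈ₚ-unique H≈S H≈S₀) ⟩
                      firstHit S₀    ≡⟨ proj₂ found ⟩
                      just L₀        ∎))
                   w)
          (λ w → S₀ , H≈S₀ , L₀ , proj₂ found , w)

          where open ≡-Reasoning

        c'≡pick : c' H ≡ pick L₀
        c'≡pick = wellDef _ _ canonical≐

      isChoice : IsChoice (σL α') c'
      isChoice = record
        { chooses = λ H hH → Equivalence.from (H≈S₀ hH _)
                               (subst (T ∘ S₀ hH) (sym (c'≡pick hH)) (proj₂ (hit hH)))
        ; wellDef = λ K H K≐H → wellDef _ _ (canonical-cong K≐H)
        }

      refines : Refines (σL α') c' (σL α) c
      refines H hH =
        witness (deciderL α) ⟦ L₀ hH ⟧ , witness-∈ (deciderL α) (proj₁ (hit hH)) , c'≡pick hH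

    counterexample : LSeq → Maybe (List Box)
    counterexample α' = findᵇ (λ L → satL α' ⟦ L ⟧ ∧ is-nothing (firstHit ⟦ L ⟧)) boxSets

    covered-unless-counterexample : ∀ {α'} → T (is-nothing (counterexample α')) → Covered α'
    covered-unless-counterexample {α'} none {S} s with firstHit S in first
    ... | just _  = _
    ... | nothing = is-just∧is-nothing (findᵇ-complete _ (listing∈boxSets S) refuting) none
      where
      refuting : T (satL α' ⟦ listing S ⟧ ∧ is-nothing (firstHit ⟦ listing S ⟧))
      refuting = Equivalence.from T-∧
        ( sat-mono (deciderL α') (Equivalence.from listing-⇔) s
        , subst (T ∘ is-nothing) (sym (trans (firstHit-cong (listing≗ S)) first)) _ )

    some-covered : {I : Set} (ηs : List I) (f : I → LSeq) →
      (∀ {S} → (∀ {η} → η ∈ ηs → T (satL (f η) S)) → T (satL α S)) →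
      Σ I λ η → η ∈ ηs × Covered (f η)
    some-covered {I} ηs f expand with findᵇ (is-nothing ∘ counterexample ∘ f) ηs in first
    ... | just η  = let m , none = findᵇ-sound (is-nothing ∘ counterexample ∘ f) ηs first
                    in η , m , covered-unless-counterexample {f η} none
    ... | nothing = let η , m , inBad = culprit in ⊥-elim (is-just∧is-nothing
      (findᵇ-complete _ (listing∈boxSets ⋃bad) (Equivalence.from T-∧ (proj₁ chosen , inBad)))
      (proj₂ (bad m)))
      where
      badSet : I → List Box
      badSet η = fromMaybe [] (counterexample (f η))

      refuted : ∀ {η} → η ∈ ηs → counterexample (f η) ≡ just (badSet η)
      refuted {η} m with counterexample (f η) in eq
      ... | just _  = refl
      ... | nothing = ⊥-elim (subst (T ∘ is-just) first
                        (findᵇ-complete (is-nothing ∘ counterexample ∘ f) m (subst (T ∘ is-nothing) (sym eq) _)))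

      bad : ∀ {η} → η ∈ ηs → T (satL (f η) ⟦ badSet η ⟧) × T (is-nothing (firstHit ⟦ badSet η ⟧))
      bad m = Equivalence.to T-∧ (proj₂ (findᵇ-sound _ boxSets (refuted m)))

      -- The union of the non-hit sets S_η of the refuter argument.
      ⋃bad : Pred
      ⋃bad b = any (λ η → ⟦ badSet η ⟧ b) ηs

      chosen : T (satL α ⟦ listing ⋃bad ⟧) × T (⋃bad (pick (listing ⋃bad)))
      chosen = Equivalence.to T-∧ (hits-listing (expand λ m →
        sat-mono (deciderL (f _)) (λ t → any⁺ _ (lose m t)) (proj₁ (bad m))))

      culprit : ∃ λ η → η ∈ ηs × T (⟦ badSet η ⟧ (pick (listing ⋃bad)))
      culprit = find (any⁻ _ ηs (proj₂ chosen))

  module _ (w : List (Terminal × ℕ)) {X : N} (j : ℕ) (β : LSeq) {c : Clause → Box}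
           (isC : IsChoice (σL (termSeq w ++ (inj₂ X , suc j) ∷ β)) c) where
    open Refinement (termSeq w ++ (inj₂ X , suc j) ∷ β) c isC

    expansion : List Sym → LSeq
    expansion η = termSeq w ++ constLevels j η ++ β

    prover-refinement : owner X ≡ prover → ∀ η → X ⟶ η →
                        RefiningChoice (expansion η) (termSeq w ++ (inj₂ X , suc j) ∷ β) c
    prover-refinement po η r =
      refining-choice (expansion η) (covered-by-sat (expansion η) (satL-expand-prover w j β po r))

    refuter-refinement : owner X ≡ refuter → Σ (List Sym) λ η → X ⟶ η ×
                         RefiningChoice (expansion η) (termSeq w ++ (inj₂ X , suc j) ∷ β) c
    refuter-refinement ro =
      let η , m , covered = some-covered (rulesOf X) expansion
                              (λ sat-all → satL-expand-refuter w j β ro (sat-all ∘ ∈-rulesOf⁺))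
      in η , ∈-rulesOf⁻ m , refining-choice (expansion η) covered

lemma26 : (G : Grammar) (A : Automaton (Grammar.nT G)) →
    let open Semantics G A in
    (wℓ : List (T × ℕ)) (X : N) (i : ℕ) (βℓ : LSeq) →
    0 < i → (∀ Y k → (inj₂ Y , k) ∈ βℓ → 0 < k) →
    (c : Clause → Box) → IsChoice (σL (termSeq wℓ ++ (inj₂ X , i) ∷ βℓ)) c →
    (owner X ≡ prover → ∀ η → X ⟶ η →
      Σ (Clause → Box) λ cη →
        IsChoice (σL (termSeq wℓ ++ constLevels (i ∸ 1) η ++ βℓ)) cη ×
        Refines (σL (termSeq wℓ ++ constLevels (i ∸ 1) η ++ βℓ)) cη
                (σL (termSeq wℓ ++ (inj₂ X , i) ∷ βℓ)) c) ×
    (owner X ≡ refuter → Σ (List Sym) λ η → X ⟶ η ×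
      Σ (Clause → Box) λ cη →
        IsChoice (σL (termSeq wℓ ++ constLevels (i ∸ 1) η ++ βℓ)) cη ×
        Refines (σL (termSeq wℓ ++ constLevels (i ∸ 1) η ++ βℓ)) cη
                (σL (termSeq wℓ ++ (inj₂ X , i) ∷ βℓ)) c)
lemma26 G A w X zero    β ()
lemma26 G A w X (suc j) β _ _ c isC = prover-refinement w j β isC , refuter-refinement w j β isC
  where open Development G A
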